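{- In $\mathrm{E\text{ - }HA}^{\omega*}_{\mathrm{st}}$, the underspill principle $\mathrm{US}_0$ implies $\mathrm{MP}_0$: for every internal formula $\varphi$ (possibly with parameters), $(\forall^{\mathrm{st}}x^0(\varphi(x)\lor\neg\varphi(x))\land\neg\neg\exists^{\mathrm{st}}x^0\varphi(x))\to\exists^{\mathrm{st}}x^0\varphi(x)$. In particular $\mathrm{E\text{ - }HA}^{\omega*}_{\mathrm{st}}+\mathrm{US}_0\vdash\neg\neg\mathrm{st}^0(x)\to\mathrm{st}^0(x)$.
   Context: Finite types: $0$, $\sigma\to\tau$, $\sigma^*$ (finite sequences). $\mathcal T^*$: Gödel's T extended with $\varepsilon_\sigma$, prepending $c$, list recursors. $\mathrm{E\text{ - }HA}^{\omega*}$: intuitionistic extensional arithmetic in these types over $\mathcal T^*$ with full induction and $\forall y^{\sigma^*}(y=\varepsilon\lor\exists a,x\,y=c(a,x))$. $\mathrm{E\text{ - }HA}^{\omega*}_{\mathrm{st}}$: add predicates $\mathrm{st}^\sigma$, quantifiers $\forall^{\mathrm{st}},\exists^{\mathrm{st}}$ (formulas without them are internal), axioms $\forall^{\mathrm{st}}x\Phi\leftrightarrow\forall x(\mathrm{st}(x)\to\Phi)$, $\exists^{\mathrm{st}}x\Phi\leftrightarrow\exists x(\mathrm{st}(x)\land\Phi)$, $\mathrm{st}(x)\land x=y\to\mathrm{st}(y)$, $\mathrm{st}(t)$ for closed $t\in\mathcal T^*$, $\mathrm{st}(f)\land\mathrm{st}(x)\to\mathrm{st}(fx)$, external induction $\Phi(0)\land\forall^{\mathrm{st}}n(\Phi(n)\to\Phi(n+1))\to\forall^{\mathrm{st}}n\Phi(n)$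 for all $\Phi$; internal induction only for internal formulas; intuitionistic logic. $\mathrm{US}_0$: $\forall x^0(\neg\mathrm{st}(x)\to\varphi(x))\to\exists^{\mathrm{st}}x^0\varphi(x)$ for internal $\varphi$ (parameters allowed). -}

module Defs where

open import Data.List using (List; []; _∷_; map)
open import Data.List.Membership.Propositional using (_∈_)
open import Data.Empty using (⊥)
open import Data.Unit using (⊤)
open import Data.Product using (_×_)

infixr 20 _⇒_
data Ty : Set where
  N   : Ty
  _⇒_ : Ty → Ty → Ty
  Seq : Ty → Ty

Ctx : Set
Ctx = List Ty

infix 4 _∋_
data _∋_ : Ctx → Ty → Set where
  here  : ∀ {Γ σ} → (σ ∷ Γ) ∋ σ
  there : ∀ {Γ σ τ} → Γ ∋ σ → (τ ∷ Γ) ∋ σ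

data Const : Ty → Set where
  zer  : Const N
  succ : Const (N ⇒ N)
  K    : ∀ σ τ → Const (σ ⇒ τ ⇒ σ)
  S    : ∀ ρ σ τ → Const ((ρ ⇒ σ ⇒ τ) ⇒ (ρ ⇒ σ) ⇒ ρ ⇒ τ)
  R    : ∀ σ → Const (σ ⇒ (σ ⇒ N ⇒ σ) ⇒ N ⇒ σ)
  nil  : ∀ σ → Const (Seq σ)
  cons : ∀ σ → Const (σ ⇒ Seq σ ⇒ Seq σ)
  L    : ∀ σ ρ → Const (ρ ⇒ (σ ⇒ Seq σ ⇒ ρ ⇒ ρ) ⇒ Seq σ ⇒ ρ)

infixl 30 _·_
data Term (Γ : Ctx) : Ty → Set where
  var : ∀ {σ} → Γ ∋ σ → Term Γ σ
  con : ∀ {σ} → Const σ → Term Γ σ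
  _·_ : ∀ {σ τ} → Term Γ (σ ⇒ τ) → Term Γ σ → Term Γ τ

Ren : Ctx → Ctx → Set
Ren Γ Δ = ∀ {σ} → Γ ∋ σ → Δ ∋ σ

Sub : Ctx → Ctx → Set
Sub Γ Δ = ∀ {σ} → Γ ∋ σ → Term Δ σ

liftR : ∀ {Γ Δ τ} → Ren Γ Δ → Ren (τ ∷ Γ) (τ ∷ Δ)
liftR ρ here      = here
liftR ρ (there x) = there (ρ x)

renT : ∀ {Γ Δ σ} → Ren Γ Δ → Term Γ σ → Term Δ σ
renT ρ (var x) = var (ρ x)
renT ρ (con c) = con c
renT ρ (t · u) = renT ρ t · renT ρ u

wkT : ∀ {Γ σ τ} → Term Γ σ → Term (τ ∷ Γ) σ
wkT = renT there

liftS : ∀ {Γ Δ τ} → Sub Γ Δ → Sub (τ ∷ Γ) (τ ∷ Δ)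
liftS s here      = var here
liftS s (there x) = wkT (s x)

subT : ∀ {Γ Δ σ} → Sub Γ Δ → Term Γ σ → Term Δ σ
subT s (var x) = s x
subT s (con c) = con c
subT s (t · u) = subT s t · subT s u

closedIn : ∀ {Γ σ} → Term [] σ → Term Γ σ
closedIn = renT (λ ())

infix  25 _≐_
infixr 15 _∧'_
infixr 14 _∨'_
infixr 13 _⇒'_
data Form (Γ : Ctx) : Set where
  _≐_  : ∀ {σ} → Term Γ σ → Term Γ σ → Form Γ
  St   : ∀ {σ} → Term Γ σ → Form Γ
  ⊥'   : Form Γ
  _∧'_ : Form Γ → Form Γ → Form Γ
  _∨'_ : Form Γ → Form Γ → Form Γ
  _⇒'_ : Form Γ → Form Γ → Form Γ
  All  : ∀ σ → Form (σ ∷ Γ) → Form Γ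
  Ex   : ∀ σ → Form (σ ∷ Γ) → Form Γ

renF : ∀ {Γ Δ} → Ren Γ Δ → Form Γ → Form Δ
renF ρ (t ≐ u)  = renT ρ t ≐ renT ρ u
renF ρ (St t)   = St (renT ρ t)
renF ρ ⊥'       = ⊥'
renF ρ (A ∧' B) = renF ρ A ∧' renF ρ B
renF ρ (A ∨' B) = renF ρ A ∨' renF ρ B
renF ρ (A ⇒' B) = renF ρ A ⇒' renF ρ B
renF ρ (All σ A) = All σ (renF (liftR ρ) A)
renF ρ (Ex σ A)  = Ex σ (renF (liftR ρ) A)

subF : ∀ {Γ Δ} → Sub Γ Δ → Form Γ → Form Δ
subF s (t ≐ u)  = subT s t ≐ subT s u
subF s (St t)   = St (subT s t)
subF s ⊥'       = ⊥'
subF s (A ∧' B) = subF s A ∧' subF s B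
subF s (A ∨' B) = subF s A ∨' subF s B
subF s (A ⇒' B) = subF s A ⇒' subF s B
subF s (All σ A) = All σ (subF (liftS s) A)
subF s (Ex σ A)  = Ex σ (subF (liftS s) A)

wkF : ∀ {Γ τ} → Form Γ → Form (τ ∷ Γ)
wkF = renF there

_[_] : ∀ {Γ σ} → Form (σ ∷ Γ) → Term Γ σ → Form Γ
_[_] {Γ} {σ} A t = subF s A
  where
  s : Sub (σ ∷ Γ) Γ
  s here      = t
  s (there x) = var x

_⟨_⟩ : ∀ {Γ σ} → Form (σ ∷ Γ) → Term (σ ∷ Γ) σ → Form (σ ∷ Γ)
_⟨_⟩ {Γ} {σ} A t = subF s A
  where
  s : Sub (σ ∷ Γ) (σ ∷ Γ)
  s here      = t
  s (there x) = var (there x)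

-- Derived connectives and the standard quantifiers.  The axioms
-- ∀st x Φ ↔ ∀x(st x → Φ), ∃st x Φ ↔ ∃x(st x ∧ Φ) are realised
-- definitionally.
¬'_ : ∀ {Γ} → Form Γ → Form Γ
¬' A = A ⇒' ⊥'

AllSt : ∀ {Γ} σ → Form (σ ∷ Γ) → Form Γ
AllSt σ A = All σ (St (var here) ⇒' A)

ExSt : ∀ {Γ} σ → Form (σ ∷ Γ) → Form Γ
ExSt σ A = Ex σ (St (var here) ∧' A)

Internal : ∀ {Γ} → Form Γ → Set
Internal (t ≐ u)  = ⊤
Internal (St t)   = ⊥
Internal ⊥'       = ⊤
Internal (A ∧' B) = Internal A × Internal B
Internal (A ∨' B) = Internal A × Internal B
Internal (A ⇒' B) = Internal A × Internal B
Internal (All σ A) = Internal A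
Internal (Ex σ A)  = Internal A

zero' : ∀ {Γ} → Term Γ N
zero' = con zer

suc' : ∀ {Γ} → Term Γ N → Term Γ N
suc' t = con succ · t

v0 : ∀ {Γ σ} → Term (σ ∷ Γ) σ
v0 = var here

v1 : ∀ {Γ σ τ} → Term (τ ∷ σ ∷ Γ) σ
v1 = var (there here)

-- Axioms (schemata, instantiated in an arbitrary context Γ, so that
-- free variables act as parameters)

Theory : Set₁
Theory = ∀ {Γ} → Form Γ → Set

data AxEHA {Γ : Ctx} : Form Γ → Set where
  eq-refl : ∀ {σ} (t : Term Γ σ) → AxEHA (t ≐ t)
  eq-leib : ∀ {σ} (A : Form (σ ∷ Γ)) → Internal A → (t u : Term Γ σ) →
            AxEHA ((t ≐ u) ⇒' A [ t ] ⇒' A [ u ])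
  eq-ext  : ∀ {σ τ} (f g : Term Γ (σ ⇒ τ)) →
            AxEHA (All σ (wkT f · v0 ≐ wkT g · v0) ⇒' (f ≐ g))
  suc-nz  : (t : Term Γ N) → AxEHA (¬' (suc' t ≐ zero'))
  suc-inj : (t u : Term Γ N) → AxEHA ((suc' t ≐ suc' u) ⇒' (t ≐ u))
  ind     : (A : Form (N ∷ Γ)) → Internal A →
            AxEHA (A [ zero' ] ⇒' All N (A ⇒' A ⟨ suc' v0 ⟩) ⇒' All N A)
  K-eq    : ∀ {σ τ} (x : Term Γ σ) (y : Term Γ τ) →
            AxEHA (con (K σ τ) · x · y ≐ x)
  S-eq    : ∀ {ρ σ τ} (x : Term Γ (ρ ⇒ σ ⇒ τ)) (y : Term Γ (ρ ⇒ σ)) (z : Term Γ ρ) →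
            AxEHA (con (S ρ σ τ) · x · y · z ≐ x · z · (y · z))
  R-zero  : ∀ {σ} (x : Term Γ σ) (y : Term Γ (σ ⇒ N ⇒ σ)) →
            AxEHA (con (R σ) · x · y · zero' ≐ x)
  R-suc   : ∀ {σ} (x : Term Γ σ) (y : Term Γ (σ ⇒ N ⇒ σ)) (n : Term Γ N) →
            AxEHA (con (R σ) · x · y · suc' n ≐ y · (con (R σ) · x · y · n) · n)
  L-nil   : ∀ {σ ρ} (a : Term Γ ρ) (f : Term Γ (σ ⇒ Seq σ ⇒ ρ ⇒ ρ)) →
            AxEHA (con (L σ ρ) · a · f · con (nil σ) ≐ a)
  L-cons  : ∀ {σ ρ} (a : Term Γ ρ) (f : Term Γ (σ ⇒ Seq σ ⇒ ρ ⇒ ρ))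
              (x : Term Γ σ) (l : Term Γ (Seq σ)) →
            AxEHA (con (L σ ρ) · a · f · (con (cons σ) · x · l)
                     ≐ f · x · l · (con (L σ ρ) · a · f · l))
  seq-cases : ∀ {σ} (y : Term Γ (Seq σ)) →
            AxEHA ((y ≐ con (nil σ)) ∨'
                   Ex σ (Ex (Seq σ) (wkT (wkT y) ≐ con (cons σ) · v1 · v0)))

data AxEHAst {Γ : Ctx} : Form Γ → Set where
  base     : ∀ {A} → AxEHA A → AxEHAst A
  st-eq    : ∀ {σ} (t u : Term Γ σ) → AxEHAst ((St t ∧' (t ≐ u)) ⇒' St u)
  st-closed : ∀ {σ} (t : Term [] σ) → AxEHAst (St (closedIn {Γ} t))
  st-app   : ∀ {σ τ} (f : Term Γ (σ ⇒ τ)) (x : Term Γ σ) →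
             AxEHAst ((St f ∧' St x) ⇒' St (f · x))
  ext-ind  : (A : Form (N ∷ Γ)) →
             AxEHAst (A [ zero' ] ⇒' AllSt N (A ⇒' A ⟨ suc' v0 ⟩) ⇒' AllSt N A)

data AxEHAstUS {Γ : Ctx} : Form Γ → Set where
  base : ∀ {A} → AxEHAst A → AxEHAstUS A
  US₀  : (φ : Form (N ∷ Γ)) → Internal φ →
         AxEHAstUS (All N (¬' St v0 ⇒' φ) ⇒' ExSt N φ)

data Pf (T : Theory) : (Γ : Ctx) → List (Form Γ) → Form Γ → Set where
  hyp  : ∀ {Γ Δ A} → A ∈ Δ → Pf T Γ Δ A
  ax   : ∀ {Γ Δ A} → T A → Pf T Γ Δ A
  ⊥E   : ∀ {Γ Δ A} → Pf T Γ Δ ⊥' → Pf T Γ Δ A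
  ∧I   : ∀ {Γ Δ A B} → Pf T Γ Δ A → Pf T Γ Δ B → Pf T Γ Δ (A ∧' B)
  ∧E₁  : ∀ {Γ Δ A B} → Pf T Γ Δ (A ∧' B) → Pf T Γ Δ A
  ∧E₂  : ∀ {Γ Δ A B} → Pf T Γ Δ (A ∧' B) → Pf T Γ Δ B
  ∨I₁  : ∀ {Γ Δ A B} → Pf T Γ Δ A → Pf T Γ Δ (A ∨' B)
  ∨I₂  : ∀ {Γ Δ A B} → Pf T Γ Δ B → Pf T Γ Δ (A ∨' B)
  ∨E   : ∀ {Γ Δ A B C} → Pf T Γ Δ (A ∨' B) → Pf T Γ (A ∷ Δ) C →
         Pf T Γ (B ∷ Δ) C → Pf T Γ Δ C
  ⇒I   : ∀ {Γ Δ A B} → Pf T Γ (A ∷ Δ) B → Pf T Γ Δ (A ⇒' B)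
  ⇒E   : ∀ {Γ Δ A B} → Pf T Γ Δ (A ⇒' B) → Pf T Γ Δ A → Pf T Γ Δ B
  ∀I   : ∀ {Γ Δ σ A} → Pf T (σ ∷ Γ) (map wkF Δ) A → Pf T Γ Δ (All σ A)
  ∀E   : ∀ {Γ Δ σ A} → Pf T Γ Δ (All σ A) → (t : Term Γ σ) → Pf T Γ Δ (A [ t ])
  ∃I   : ∀ {Γ Δ σ A} (t : Term Γ σ) → Pf T Γ Δ (A [ t ]) → Pf T Γ Δ (Ex σ A)
  ∃E   : ∀ {Γ Δ σ A C} → Pf T Γ Δ (Ex σ A) →
         Pf T (σ ∷ Γ) (A ∷ map wkF Δ) (wkF C) → Pf T Γ Δ C

_⊢US_ : (Γ : Ctx) → Form Γ → Set
Γ ⊢US A = Pf AxEHAstUS Γ [] A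

-- Given that φ is decidable on standard numbers and ¬¬∃st x. φ x, apply US₀ to
-- ψ(y) := ¬¬∃x ≤ y. φ x.  Every standard number lies below every nonstandard y, so ψ holds at all
-- nonstandard y and US₀ yields a standard y with ψ(y).  External induction on standard n,
-- deciding φ at each step, shows that either a standard witness exists or φ fails on all x ≤ n;
-- at n = y the latter contradicts ψ(y).  Applied to φ y := (y = x) this gives ¬¬st x → st x.

module Submission where

open import Defs
open import Data.Product using (_×_; _,_)
open import Data.List using (List; []; _∷_; map)
open import Data.List.Relation.Unary.Any using () renaming (here to hd; there to tl)
open import Data.Unit using (tt)
open import Relation.Binary.PropositionalEquality
  using (_≡_; refl; sym; trans; cong; cong₂; subst)

infix 4 _≗ˢ_
_≗ˢ_ : ∀ {Γ Δ} → Sub Γ Δ → Sub Γ Δ → Set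
_≗ˢ_ {Γ} s s' = ∀ {σ} (x : Γ ∋ σ) → s x ≡ s' x

single : ∀ {Γ σ} → Term Γ σ → Sub (σ ∷ Γ) Γ
single t here      = t
single t (there x) = var x

subT-cong : ∀ {Γ Δ σ} {s s' : Sub Γ Δ} → s ≗ˢ s' → (t : Term Γ σ) → subT s t ≡ subT s' t
subT-cong e (var x) = e x
subT-cong e (con c) = refl
subT-cong e (t · u) = cong₂ _·_ (subT-cong e t) (subT-cong e u)

liftS-cong : ∀ {Γ Δ τ} {s s' : Sub Γ Δ} → s ≗ˢ s' → liftS {τ = τ} s ≗ˢ liftS s'
liftS-cong e here      = refl
liftS-cong e (there x) = cong wkT (e x)

subF-cong : ∀ {Γ Δ} {s s' : Sub Γ Δ} → s ≗ˢ s' → (A : Form Γ) → subF s A ≡ subF s' A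
subF-cong e (t ≐ u)   = cong₂ _≐_ (subT-cong e t) (subT-cong e u)
subF-cong e (St t)    = cong St (subT-cong e t)
subF-cong e ⊥'        = refl
subF-cong e (A ∧' B)  = cong₂ _∧'_ (subF-cong e A) (subF-cong e B)
subF-cong e (A ∨' B)  = cong₂ _∨'_ (subF-cong e A) (subF-cong e B)
subF-cong e (A ⇒' B)  = cong₂ _⇒'_ (subF-cong e A) (subF-cong e B)
subF-cong e (All σ A) = cong (All σ) (subF-cong (liftS-cong e) A)
subF-cong e (Ex σ A)  = cong (Ex σ) (subF-cong (liftS-cong e) A)

subT-var : ∀ {Γ σ} (t : Term Γ σ) → subT var t ≡ t
subT-var (var x) = refl
subT-var (con c) = refl
subT-var (t · u) = cong₂ _·_ (subT-var t) (subT-var u)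

liftS-var : ∀ {Γ τ} → liftS {Γ} {τ = τ} var ≗ˢ var
liftS-var here      = refl
liftS-var (there x) = refl

subF-var : ∀ {Γ} (A : Form Γ) → subF var A ≡ A
subF-var (t ≐ u)   = cong₂ _≐_ (subT-var t) (subT-var u)
subF-var (St t)    = cong St (subT-var t)
subF-var ⊥'        = refl
subF-var (A ∧' B)  = cong₂ _∧'_ (subF-var A) (subF-var B)
subF-var (A ∨' B)  = cong₂ _∨'_ (subF-var A) (subF-var B)
subF-var (A ⇒' B)  = cong₂ _⇒'_ (subF-var A) (subF-var B)
subF-var (All σ A) = cong (All σ) (trans (subF-cong liftS-var A) (subF-var A))
subF-var (Ex σ A)  = cong (Ex σ) (trans (subF-cong liftS-var A) (subF-var A))

renT-as-subT : ∀ {Γ Δ σ} (ρ : Ren Γ Δ) (t : Term Γ σ) → renT ρ t ≡ subT (λ x → var (ρ x)) t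
renT-as-subT ρ (var x) = refl
renT-as-subT ρ (con c) = refl
renT-as-subT ρ (t · u) = cong₂ _·_ (renT-as-subT ρ t) (renT-as-subT ρ u)

liftR-as-liftS : ∀ {Γ Δ τ} (ρ : Ren Γ Δ) →
  (λ x → var (liftR {τ = τ} ρ x)) ≗ˢ liftS (λ x → var (ρ x))
liftR-as-liftS ρ here      = refl
liftR-as-liftS ρ (there x) = refl

renF-as-subF : ∀ {Γ Δ} (ρ : Ren Γ Δ) (A : Form Γ) → renF ρ A ≡ subF (λ x → var (ρ x)) A
renF-as-subF ρ (t ≐ u)   = cong₂ _≐_ (renT-as-subT ρ t) (renT-as-subT ρ u)
renF-as-subF ρ (St t)    = cong St (renT-as-subT ρ t)
renF-as-subF ρ ⊥'        = refl
renF-as-subF ρ (A ∧' B)  = cong₂ _∧'_ (renF-as-subF ρ A) (renF-as-subF ρ B)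
renF-as-subF ρ (A ∨' B)  = cong₂ _∨'_ (renF-as-subF ρ A) (renF-as-subF ρ B)
renF-as-subF ρ (A ⇒' B)  = cong₂ _⇒'_ (renF-as-subF ρ A) (renF-as-subF ρ B)
renF-as-subF ρ (All σ A) =
  cong (All σ) (trans (renF-as-subF (liftR ρ) A) (subF-cong (liftR-as-liftS ρ) A))
renF-as-subF ρ (Ex σ A)  =
  cong (Ex σ) (trans (renF-as-subF (liftR ρ) A) (subF-cong (liftR-as-liftS ρ) A))

subT-∘ : ∀ {Γ Δ Θ σ} (s : Sub Γ Δ) (s' : Sub Δ Θ) (t : Term Γ σ) →
  subT s' (subT s t) ≡ subT (λ x → subT s' (s x)) t
subT-∘ s s' (var x) = refl
subT-∘ s s' (con c) = refl
subT-∘ s s' (t · u) = cong₂ _·_ (subT-∘ s s' t) (subT-∘ s s' u)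

subT-liftS-wkT : ∀ {Γ Δ σ τ} (s : Sub Γ Δ) (t : Term Γ σ) →
  subT (liftS {τ = τ} s) (wkT t) ≡ wkT (subT s t)
subT-liftS-wkT s (var x) = refl
subT-liftS-wkT s (con c) = refl
subT-liftS-wkT s (t · u) = cong₂ _·_ (subT-liftS-wkT s t) (subT-liftS-wkT s u)

subT-single-wkT : ∀ {Γ σ τ} (t : Term Γ σ) (u : Term Γ τ) → subT (single t) (wkT u) ≡ u
subT-single-wkT t (var x) = refl
subT-single-wkT t (con c) = refl
subT-single-wkT t (u · w) = cong₂ _·_ (subT-single-wkT t u) (subT-single-wkT t w)

liftS-∘ : ∀ {Γ Δ Θ τ} (s : Sub Γ Δ) (s' : Sub Δ Θ) →
  (λ x → subT (liftS {τ = τ} s') (liftS s x)) ≗ˢ liftS (λ x → subT s' (s x))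
liftS-∘ s s' here      = refl
liftS-∘ s s' (there x) = subT-liftS-wkT s' (s x)

subF-∘ : ∀ {Γ Δ Θ} (s : Sub Γ Δ) (s' : Sub Δ Θ) (A : Form Γ) →
  subF s' (subF s A) ≡ subF (λ x → subT s' (s x)) A
subF-∘ s s' (t ≐ u)   = cong₂ _≐_ (subT-∘ s s' t) (subT-∘ s s' u)
subF-∘ s s' (St t)    = cong St (subT-∘ s s' t)
subF-∘ s s' ⊥'        = refl
subF-∘ s s' (A ∧' B)  = cong₂ _∧'_ (subF-∘ s s' A) (subF-∘ s s' B)
subF-∘ s s' (A ∨' B)  = cong₂ _∨'_ (subF-∘ s s' A) (subF-∘ s s' B)
subF-∘ s s' (A ⇒' B)  = cong₂ _⇒'_ (subF-∘ s s' A) (subF-∘ s s' B)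
subF-∘ s s' (All σ A) =
  cong (All σ) (trans (subF-∘ (liftS s) (liftS s') A) (subF-cong (liftS-∘ s s') A))
subF-∘ s s' (Ex σ A)  =
  cong (Ex σ) (trans (subF-∘ (liftS s) (liftS s') A) (subF-cong (liftS-∘ s s') A))

Internal-subF : ∀ {Γ Δ} (s : Sub Γ Δ) (A : Form Γ) → Internal A → Internal (subF s A)
Internal-subF s (t ≐ u)   i       = tt
Internal-subF s ⊥'        i       = tt
Internal-subF s (A ∧' B)  (i , j) = Internal-subF s A i , Internal-subF s B j
Internal-subF s (A ∨' B)  (i , j) = Internal-subF s A i , Internal-subF s B j
Internal-subF s (A ⇒' B)  (i , j) = Internal-subF s A i , Internal-subF s B j
Internal-subF s (All σ A) i       = Internal-subF (liftS s) A i
Internal-subF s (Ex σ A)  i       = Internal-subF (liftS s) A i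

Internal-renF : ∀ {Γ Δ} (ρ : Ren Γ Δ) (A : Form Γ) → Internal A → Internal (renF ρ A)
Internal-renF ρ A i = subst Internal (sym (renF-as-subF ρ A)) (Internal-subF _ A i)

-- Two formulas built from one formula A by chains of renamings and substitutions are identified by
-- comparing the composite substitutions variable by variable.
infix 4 _≔_⟦_⟧
_≔_⟦_⟧ : ∀ {Γ Δ} → Form Δ → Form Γ → Sub Γ Δ → Set
X ≔ A ⟦ s ⟧ = X ≡ subF s A

≔-refl : ∀ {Γ} {A : Form Γ} → A ≔ A ⟦ var ⟧
≔-refl {A = A} = sym (subF-var A)

≔-ren : ∀ {Γ Δ Θ} {A : Form Γ} {X : Form Δ} {s : Sub Γ Δ} (ρ : Ren Δ Θ) →
  X ≔ A ⟦ s ⟧ → renF ρ X ≔ A ⟦ (λ x → renT ρ (s x)) ⟧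
≔-ren {A = A} {s = s} ρ refl =
  trans (renF-as-subF ρ (subF s A))
        (trans (subF-∘ s _ A) (subF-cong (λ x → sym (renT-as-subT ρ (s x))) A))

≔-sub : ∀ {Γ Δ Θ} {A : Form Γ} {X : Form Δ} {s : Sub Γ Δ} (s' : Sub Δ Θ) →
  X ≔ A ⟦ s ⟧ → subF s' X ≔ A ⟦ (λ x → subT s' (s x)) ⟧
≔-sub {A = A} {s = s} s' refl = subF-∘ s s' A

≔-unique : ∀ {Γ Δ} {A : Form Γ} {X Y : Form Δ} {s s' : Sub Γ Δ} →
  X ≔ A ⟦ s ⟧ → Y ≔ A ⟦ s' ⟧ → s ≗ˢ s' → X ≡ Y
≔-unique {A = A} p q e = trans p (trans (subF-cong e A) (sym q))

v2 : ∀ {Γ σ τ ρ} → Term (ρ ∷ τ ∷ σ ∷ Γ) σ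
v2 = var (there (there here))

v3 : ∀ {Γ σ τ ρ μ} → Term (μ ∷ ρ ∷ τ ∷ σ ∷ Γ) σ
v3 = var (there (there (there here)))

-- Addition is Gödel recursion on the second argument with step λ x n. suc x, written as S (K K) succ.
infixl 35 _+'_
_+'_ : ∀ {Γ} → Term Γ N → Term Γ N → Term Γ N
a +' d = con (R N) · a · (con (S N N (N ⇒ N)) · (con (K (N ⇒ N ⇒ N) N) · con (K N N)) · con succ) · d

infix 25 _≤'_
_≤'_ : ∀ {Γ} → Term Γ N → Term Γ N → Form Γ
a ≤' b = Ex N (wkT a +' v0 ≐ wkT b)


module Arithmetic (T : Theory) (eha : ∀ {Γ} {A : Form Γ} → AxEHA A → T A) where

  infix 2 _⊢_
  _⊢_ : ∀ {Γ} → List (Form Γ) → Form Γ → Set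
  Δ ⊢ A = Pf T _ Δ A

  axiom : ∀ {Γ Δ} {A : Form Γ} → AxEHA A → Δ ⊢ A
  axiom a = ax (eha a)

  reindex : ∀ {Γ Δ} {A B : Form Γ} → A ≡ B → Δ ⊢ A → Δ ⊢ B
  reindex = subst (_ ⊢_)

  by-instance : ∀ {Γ Γ' Δ} {A : Form Γ} {X Y : Form Γ'} {s s' : Sub Γ Γ'} →
    X ≔ A ⟦ s ⟧ → Y ≔ A ⟦ s' ⟧ → s ≗ˢ s' → Δ ⊢ X → Δ ⊢ Y
  by-instance p q e = reindex (≔-unique p q e)

  #0 : ∀ {Γ Δ} {A : Form Γ} → A ∷ Δ ⊢ A
  #0 = hyp (hd refl)

  #1 : ∀ {Γ Δ} {A B : Form Γ} → B ∷ A ∷ Δ ⊢ A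
  #1 = hyp (tl (hd refl))

  #2 : ∀ {Γ Δ} {A B C : Form Γ} → C ∷ B ∷ A ∷ Δ ⊢ A
  #2 = hyp (tl (tl (hd refl)))

  #3 : ∀ {Γ Δ} {A B C D : Form Γ} → D ∷ C ∷ B ∷ A ∷ Δ ⊢ A
  #3 = hyp (tl (tl (tl (hd refl))))

  #4 : ∀ {Γ Δ} {A B C D E : Form Γ} → E ∷ D ∷ C ∷ B ∷ A ∷ Δ ⊢ A
  #4 = hyp (tl (tl (tl (tl (hd refl)))))

  []-as-single : ∀ {Γ σ} (A : Form (σ ∷ Γ)) (t : Term Γ σ) → A [ t ] ≡ subF (single t) A
  []-as-single A t = subF-cong (λ { here → refl ; (there x) → refl }) A

  leibniz : ∀ {Γ Δ σ} (A : Form (σ ∷ Γ)) → Internal A → {t u : Term Γ σ} →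
    Δ ⊢ t ≐ u → Δ ⊢ subF (single t) A → Δ ⊢ subF (single u) A
  leibniz A i {t} {u} t≐u At = reindex ([]-as-single A u)
    (⇒E (⇒E (axiom (eq-leib A i t u)) t≐u) (reindex (sym ([]-as-single A t)) At))

  ≐-refl : ∀ {Γ Δ σ} (t : Term Γ σ) → Δ ⊢ t ≐ t
  ≐-refl t = axiom (eq-refl t)

  ≐-sym : ∀ {Γ Δ σ} {t u : Term Γ σ} → Δ ⊢ t ≐ u → Δ ⊢ u ≐ t
  ≐-sym {t = t} {u} t≐u = reindex (cong (u ≐_) (subT-single-wkT u t))
    (leibniz (v0 ≐ wkT t) tt t≐u
      (reindex (cong (t ≐_) (sym (subT-single-wkT t t))) (≐-refl t)))

  ≐-trans : ∀ {Γ Δ σ} {t u w : Term Γ σ} → Δ ⊢ t ≐ u → Δ ⊢ u ≐ w → Δ ⊢ t ≐ w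
  ≐-trans {t = t} {u} {w} t≐u u≐w = reindex (cong (_≐ w) (subT-single-wkT w t))
    (leibniz (wkT t ≐ v0) tt u≐w (reindex (cong (_≐ u) (sym (subT-single-wkT u t))) t≐u))

  ≐-cong : ∀ {Γ Δ σ τ} (C : Term (σ ∷ Γ) τ) {t u : Term Γ σ} → Δ ⊢ t ≐ u →
    Δ ⊢ subT (single t) C ≐ subT (single u) C
  ≐-cong C {t} {u} t≐u = reindex (cong (_≐ subT (single u) C) (subT-single-wkT u Ct))
    (leibniz (wkT Ct ≐ C) tt t≐u
      (reindex (cong (_≐ Ct) (sym (subT-single-wkT t Ct))) (≐-refl Ct)))
    where
    Ct = subT (single t) C

  ≐-cong-suc : ∀ {Γ Δ} {t u : Term Γ N} → Δ ⊢ t ≐ u → Δ ⊢ suc' t ≐ suc' u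
  ≐-cong-suc = ≐-cong (suc' v0)

  ≐-cong-app : ∀ {Γ Δ σ τ} {f g : Term Γ (σ ⇒ τ)} (a : Term Γ σ) →
    Δ ⊢ f ≐ g → Δ ⊢ f · a ≐ g · a
  ≐-cong-app {f = f} {g} a f≐g =
    reindex (cong₂ (λ x y → f · x ≐ g · y) (subT-single-wkT f a) (subT-single-wkT g a))
      (≐-cong (v0 · wkT a) f≐g)

  +'-congˡ : ∀ {Γ Δ} (a : Term Γ N) {d e : Term Γ N} → Δ ⊢ d ≐ e → Δ ⊢ a +' d ≐ a +' e
  +'-congˡ a {d} {e} d≐e =
    reindex (cong₂ (λ x y → x +' d ≐ y +' e) (subT-single-wkT d a) (subT-single-wkT e a))
      (≐-cong (wkT a +' v0) d≐e)

  +'-zero : ∀ {Γ Δ} (a : Term Γ N) → Δ ⊢ a +' zero' ≐ a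
  +'-zero a = axiom (R-zero a _)

  +'-suc : ∀ {Γ Δ} (a d : Term Γ N) → Δ ⊢ a +' suc' d ≐ suc' (a +' d)
  +'-suc a d = ≐-trans (axiom (R-suc a _ d))
    (≐-trans (≐-cong-app d (axiom (S-eq _ (con succ) (a +' d))))
    (≐-trans (≐-cong-app d (≐-cong-app _ (axiom (K-eq (con (K N N)) (a +' d)))))
             (axiom (K-eq (suc' (a +' d)) d))))

  zero-+' : ∀ {Γ Δ} → Δ ⊢ All {Γ} N (zero' +' v0 ≐ v0)
  zero-+' = ⇒E (⇒E (axiom (ind (zero' +' v0 ≐ v0) tt)) (+'-zero zero'))
    (∀I (⇒I (≐-trans (+'-suc zero' v0) (≐-cong-suc #0))))

  suc-+' : ∀ {Γ Δ} → Δ ⊢ All {Γ} N (All N (suc' v1 +' v0 ≐ suc' (v1 +' v0)))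
  suc-+' = ∀I (⇒E (⇒E (axiom (ind (suc' v1 +' v0 ≐ suc' (v1 +' v0)) tt))
      (≐-trans (+'-zero (suc' v0)) (≐-sym (≐-cong-suc (+'-zero v0)))))
    (∀I (⇒I (≐-trans (+'-suc (suc' v1) v0)
      (≐-trans (≐-cong-suc #0) (≐-sym (≐-cong-suc (+'-suc v1 v0))))))))

  zero-or-suc : ∀ {Γ Δ} (t : Term Γ N) → Δ ⊢ t ≐ zero' ∨' Ex N (wkT t ≐ suc' v0)
  zero-or-suc t = ∀E (⇒E (⇒E (axiom (ind (v0 ≐ zero' ∨' Ex N (v1 ≐ suc' v0)) (tt , tt)))
      (∨I₁ (≐-refl zero')))
    (∀I (⇒I (∨I₂ (∃I v0 (≐-refl (suc' v0))))))) t

  ≤'-zero : ∀ {Γ Δ} → Δ ⊢ All {Γ} N (v0 ≤' zero' ⇒' v0 ≐ zero')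
  ≤'-zero = ∀I (⇒I (∃E #0 (∨E (zero-or-suc v0)
    (≐-trans (≐-sym (+'-zero v1)) (≐-trans (+'-congˡ v1 (≐-sym #0)) #1))
    (∃E #0 (⊥E (⇒E (axiom (suc-nz (v2 +' v0)))
      (≐-trans (≐-sym (+'-suc v2 v0)) (≐-trans (+'-congˡ v2 (≐-sym #0)) #2))))))))

  ≤'-suc : ∀ {Γ Δ} → Δ ⊢ All {Γ} N (All N (v1 ≤' suc' v0 ⇒' v1 ≤' v0 ∨' v1 ≐ suc' v0))
  ≤'-suc = ∀I (∀I (⇒I (∃E #0 (∨E (zero-or-suc v0)
    (∨I₂ (≐-trans (≐-sym (+'-zero v2)) (≐-trans (+'-congˡ v2 (≐-sym #0)) #1)))
    (∃E #0 (∨I₁ (∃I v0 (⇒E (axiom (suc-inj (v3 +' v0) v2))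
      (≐-trans (≐-sym (+'-suc v3 v0)) (≐-trans (+'-congˡ v3 (≐-sym #0)) #2))))))))))

  ≤'-≐-or-suc-≤' : ∀ {Γ Δ} → Δ ⊢ All {Γ} N (All N (v1 ≤' v0 ⇒' v1 ≐ v0 ∨' suc' v1 ≤' v0))
  ≤'-≐-or-suc-≤' = ∀I (∀I (⇒I (∃E #0 (∨E (zero-or-suc v0)
    (∨I₁ (≐-trans (≐-sym (+'-zero v2)) (≐-trans (+'-congˡ v2 (≐-sym #0)) #1)))
    (∃E #0 (∨I₂ (∃I v0 (≐-trans (∀E (∀E suc-+' v3) v0)
      (≐-trans (≐-sym (+'-suc v3 v0)) (≐-trans (+'-congˡ v3 (≐-sym #0)) #2))))))))))

  ≐-dec : ∀ {Γ Δ} → Δ ⊢ All {Γ} N (All N (v1 ≐ v0 ∨' ¬' (v1 ≐ v0)))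
  ≐-dec = ⇒E (⇒E (axiom (ind (All N (v1 ≐ v0 ∨' ¬' (v1 ≐ v0))) (tt , (tt , tt))))
      (∀I (∨E (zero-or-suc v0) (∨I₁ (≐-sym #0))
        (∃E #0 (∨I₂ (⇒I (⇒E (axiom (suc-nz v0)) (≐-trans (≐-sym #1) (≐-sym #0)))))))))
    (∀I (⇒I (∀I (∨E (zero-or-suc v0)
      (∨I₂ (⇒I (⇒E (axiom (suc-nz v1)) (≐-trans #0 #1))))
      (∃E #0 (∨E (∀E #2 v0)
        (∨I₁ (≐-trans (≐-cong-suc #0) (≐-sym #1)))
        (∨I₂ (⇒I (⇒E #1 (⇒E (axiom (suc-inj v2 v0)) (≐-trans #0 #2)))))))))))

wkF₁ : ∀ {Γ σ τ} → Form (σ ∷ Γ) → Form (σ ∷ τ ∷ Γ)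
wkF₁ = renF (liftR there)

Decided : ∀ {Γ} → Form (N ∷ Γ) → Form Γ
Decided φ = AllSt N (φ ∨' ¬' φ)

NoneUpTo : ∀ {Γ} → Form (N ∷ Γ) → Form (N ∷ Γ)
NoneUpTo φ = All N (v0 ≤' v1 ⇒' ¬' wkF₁ φ)

module Standardness (T : Theory) (est : ∀ {Γ} {A : Form Γ} → AxEHAst A → T A) where

  open Arithmetic T (λ a → est (base a)) public

  st-axiom : ∀ {Γ Δ} {A : Form Γ} → AxEHAst A → Δ ⊢ A
  st-axiom a = ax (est a)

  st-zero : ∀ {Γ} {Δ : List (Form Γ)} → Δ ⊢ St zero'
  st-zero = st-axiom (st-closed (con zer))

  st-suc : ∀ {Γ Δ} {t : Term Γ N} → Δ ⊢ St t → Δ ⊢ St (suc' t)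
  st-suc {t = t} st-t = ⇒E (st-axiom (st-app (con succ) t)) (∧I (st-axiom (st-closed (con succ))) st-t)

  -- External induction on x: x ≤ y gives x = y or suc x ≤ y, and x = y would make y standard.
  standard-≤'-nonstandard : ∀ {Γ Δ} → Δ ⊢ AllSt {Γ} N (All N (¬' St v0 ⇒' v1 ≤' v0))
  standard-≤'-nonstandard =
    ⇒E (⇒E (st-axiom (ext-ind (All N (¬' St v0 ⇒' v1 ≤' v0))))
        (∀I (⇒I (∃I v0 (∀E zero-+' v0)))))
      (∀I (⇒I (⇒I (∀I (⇒I (∨E (⇒E (∀E (∀E ≤'-≐-or-suc-≤' v1) v0) (⇒E (∀E #1 v0) #0))
        (⊥E (⇒E #1 (⇒E (st-axiom (st-eq v1 v0)) (∧I #3 #0))))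
        #0))))))

  bounded-search : ∀ {Γ Δ} (φ : Form (N ∷ Γ)) → Internal φ →
    Δ ⊢ Decided φ ⇒' AllSt N (wkF (ExSt N φ) ∨' NoneUpTo φ)
  bounded-search {Γ} {Δ} φ iφ = ⇒I (⇒E (⇒E (st-axiom (ext-ind Ψ)) at-zero) at-suc)
    where
    Ψ : Form (N ∷ Γ)
    Ψ = wkF (ExSt N φ) ∨' NoneUpTo φ

    renF-φ-internal : ∀ {Θ} (ρ : Ren (N ∷ Γ) Θ) → Internal (renF ρ φ)
    renF-φ-internal ρ = Internal-renF ρ φ iφ

    at-zero : Decided φ ∷ Δ ⊢ Ψ [ zero' ]
    at-zero = ∨E (⇒E (∀E #0 zero') st-zero)
      (∨I₁ (∃I zero' (∧I st-zero
        (by-instance (≔-sub _ ≔-refl) (≔-sub _ (≔-sub _ (≔-ren _ ≔-refl)))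
          (λ { here → refl ; (there x) → refl }) #0))))
      (∨I₂ (∀I (⇒I (⇒I (⇒E #2
        (by-instance (≔-sub _ (≔-ren _ ≔-refl)) (≔-ren _ (≔-sub _ ≔-refl))
          (λ { here → refl ; (there x) → refl })
          (leibniz (wkF₁ φ) (renF-φ-internal _) (⇒E (∀E ≤'-zero v0) #1)
            (by-instance (≔-sub _ (≔-ren _ ≔-refl)) (≔-sub _ (≔-ren _ ≔-refl))
              (λ { here → refl ; (there x) → refl }) #0))))))))

    at-suc : Decided φ ∷ Δ ⊢ AllSt N (Ψ ⇒' Ψ ⟨ suc' v0 ⟩)
    at-suc = ∀I (⇒I (⇒I (∨E #0
      (∨I₁ (reindex (cong (λ B → Ex N (St v0 ∧' B))
        (≔-unique (≔-ren _ ≔-refl) (≔-sub _ (≔-ren _ ≔-refl))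
          (λ { here → refl ; (there x) → refl }))) #0))
      (∨E (⇒E (∀E #3 (suc' v0)) (st-suc #2))
        (∨I₁ (∃I (suc' v0) (∧I (st-suc #3)
          (by-instance (≔-sub _ (≔-ren _ ≔-refl)) (≔-sub _ (≔-sub _ (≔-ren _ ≔-refl)))
            (λ { here → refl ; (there x) → refl }) #0))))
        (∨I₂ (∀I (⇒I (⇒I (∨E (⇒E (∀E (∀E ≤'-suc v0) v1) #1)
          (⇒E (⇒E (∀E #4 v0) #0)
            (by-instance (≔-sub _ (≔-ren _ ≔-refl)) (≔-sub _ (≔-ren _ (≔-ren _ ≔-refl)))
              (λ { here → refl ; (there x) → refl }) #1))
          (⇒E #3
            (by-instance (≔-sub _ (≔-ren _ ≔-refl)) (≔-ren _ (≔-sub _ (≔-ren _ ≔-refl)))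
              (λ { here → refl ; (there x) → refl })
              (leibniz (renF (liftR (λ x → there (there x))) φ) (renF-φ-internal _) #0
                (by-instance (≔-sub _ (≔-ren _ ≔-refl)) (≔-sub _ (≔-ren _ ≔-refl))
                  (λ { here → refl ; (there x) → refl }) #1)))))))))))))

open Standardness AxEHAstUS base

MP₀ : ∀ {Γ} → Form (N ∷ Γ) → Form Γ
MP₀ φ = Decided φ ∧' ¬' ¬' ExSt N φ ⇒' ExSt N φ

US₀⇒MP₀ : ∀ {Γ Δ} (φ : Form (N ∷ Γ)) → Internal φ → Δ ⊢ MP₀ φ
US₀⇒MP₀ {Γ} {Δ} φ iφ =
  ⇒I (∃E (⇒E (ax (US₀ SomeUpTo (((tt , Internal-renF _ φ iφ) , tt) , tt))) nonstandard) standard)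
  where
  SomeUpTo : Form (N ∷ Γ)
  SomeUpTo = ¬' ¬' Ex N (v0 ≤' v1 ∧' wkF₁ φ)

  nonstandard : Decided φ ∧' ¬' ¬' ExSt N φ ∷ Δ ⊢ All N (¬' St v0 ⇒' SomeUpTo)
  nonstandard = ∀I (⇒I (⇒I (⇒E (∧E₂ #2) (⇒I (∃E #0 (⇒E #2 (∃I v0 (∧I
    (⇒E (∀E (⇒E (∀E standard-≤'-nonstandard v0) (∧E₁ #0)) v1) #3)
    (by-instance (≔-ren _ ≔-refl) (≔-sub _ (≔-ren _ (≔-ren _ ≔-refl)))
      (λ { here → refl ; (there x) → refl }) (∧E₂ #0))))))))))

  standard : St v0 ∧' SomeUpTo ∷ map wkF (Decided φ ∧' ¬' ¬' ExSt N φ ∷ Δ) ⊢ wkF (ExSt N φ)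
  standard =
    ∨E (⇒E (∀E (⇒E (bounded-search (wkF₁ φ) (Internal-renF _ φ iφ)) (∧E₁ #1)) v0) (∧E₁ #0))
      (reindex (cong (λ B → Ex N (St v0 ∧' B))
        (≔-unique (≔-sub _ (≔-ren _ (≔-ren _ ≔-refl))) (≔-ren _ ≔-refl)
          (λ { here → refl ; (there x) → refl }))) #0)
      (⊥E (⇒E (∧E₂ #1) (⇒I (∃E #0 (⇒E (⇒E (∀E #2 v0) (∧E₁ #0))
        (by-instance (≔-ren _ ≔-refl) (≔-sub _ (≔-ren _ (≔-sub _ (≔-ren _ (≔-ren _ ≔-refl)))))
          (λ { here → refl ; (there x) → refl }) (∧E₂ #0)))))))

¬¬st⇒st : ∀ {Γ} (x : Γ ∋ N) → Γ ⊢US (¬' ¬' St (var x) ⇒' St (var x))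
¬¬st⇒st {Γ} x =
  ⇒I (∃E (⇒E (US₀⇒MP₀ (v0 ≐ x′) tt) (∧I decided ¬¬found)) (⇒E (st-axiom (st-eq v0 x′)) #0))
  where
  x′ : Term (N ∷ Γ) N
  x′ = var (there x)

  decided : ¬' ¬' St (var x) ∷ [] ⊢ Decided (v0 ≐ x′)
  decided = ∀I (⇒I (∀E (∀E ≐-dec v0) x′))

  ¬¬found : ¬' ¬' St (var x) ∷ [] ⊢ ¬' ¬' ExSt N (v0 ≐ x′)
  ¬¬found = ⇒I (⇒E #1 (⇒I (⇒E #1 (∃I (var x) (∧I #0 (≐-refl (var x)))))))

mainTheorem15 : (∀ {Γ} (φ : Form (N ∷ Γ)) → Internal φ →
    Γ ⊢US ((AllSt N (φ ∨' ¬' φ) ∧' ¬' ¬' ExSt N φ) ⇒' ExSt N φ))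
    × (∀ {Γ} (x : Γ ∋ N) → Γ ⊢US (¬' ¬' St (var x) ⇒' St (var x)))
mainTheorem15 = US₀⇒MP₀ , ¬¬st⇒st
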